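{- (In ZFC set theory.) For a graph $G$ the following are equivalent: (a) $G$ is a generalized Cayley graph of a left-quasigroup; (b) $G$ is a generalized Cayley graph of a left-quasigroup with a left identity; (c) $G$ is simple, deterministic, source-complete and co-out-regular. Likewise, the following are equivalent: (a') $G$ is a generalized Cayley graph of a left-quasigroup with a right identity; (b') $G$ is a generalized Cayley graph of a left-quasigroup with an identity; (c') $G$ is simple, deterministic, source-complete, loop-complete and co-out-regular.
   Context: A graph is a non-empty set $G\subseteq V\times A\times V$ of labeled edges $s\xrightarrow{a}_G t$; $s\to_G t$ means such an edge exists for some $a$; $V_G$ is the set of vertices occurring in edges, $A_G$ the set of labels. A graph is a generalized Cayley graph of a magma $(M,\cdot)$ if it equals $\mathcal{C}\langle M,Q\rangle=\{(p,\langle q\rangle,p\cdot q): p\in M,\ q\in Q\}$ for some $Q\subseteq M$ and injective $\langle\,\rangle:Q\to A$. A magma is a left-quasigroup if for all $p,q$ there is a unique $r$ with $p\cdot r=q$. Left identity: $e\cdot p=p$ for all $p$; right identity: $p\cdot e=p$ for all $p$; identity: both. $G$ is simple if no two edges share source and target; deterministic if $r\xrightarrow{a}s$, $r\xrightarrow{a}t$ imply $s=t$; source-complete if for every $s\in V_G$, $a\in A_G$ there is $t$ with $s\xrightarrow{a}_G t$; loop-complete if whenever some vertex has an $a$-labeled loop, every vertex has an $a$-labeled loop; co-out-regular if the cardinal $|\{t\in V_G: \text{there is no edge } s\to_G t\}|$ is the same for all $s\in V_G$. -}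

module Defs where

open import Data.Product using (Σ; ∃; ∃-syntax; _×_; _,_)
open import Data.Sum using (_⊎_)
open import Relation.Nullary using (¬_; Dec)
open import Relation.Binary.PropositionalEquality using (_≡_)
open import Data.Irrelevant using (Irrelevant)
open import Function.Bundles using (_↔_; _⇔_)

-- Classical (ZFC) ambient logic: decidability of every proposition
-- (excluded middle, which here also yields global choice).
Classical : Set₁
Classical = (P : Set) → Dec P

Graph : Set → Set → Set₁
Graph V A = V → A → V → Set

Injective : {X Y : Set} → (X → Y) → Set
Injective f = ∀ {x y} → f x ≡ f y → x ≡ y

module _ {V A : Set} (G : Graph V A) where

  NonEmpty : Set
  NonEmpty = ∃[ s ] ∃[ a ] ∃[ t ] G s a t

  _⟶_ : V → V → Set
  s ⟶ t = ∃[ a ] G s a t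

  Vertex : V → Set
  Vertex v = (∃[ a ] ∃[ t ] G v a t) ⊎ (∃[ s ] ∃[ a ] G s a v)

  Label : A → Set
  Label a = ∃[ s ] ∃[ t ] G s a t

  Simple : Set
  Simple = ∀ {s t a b} → G s a t → G s b t → a ≡ b

  Deterministic : Set
  Deterministic = ∀ {r s t a} → G r a s → G r a t → s ≡ t

  SourceComplete : Set
  SourceComplete = ∀ {s a} → Vertex s → Label a → ∃[ t ] G s a t

  LoopComplete : Set
  LoopComplete = ∀ {a} → (∃[ v ] G v a v) → ∀ {w} → Vertex w → G w a w

  -- the set {t ∈ V_G : there is no edge s →_G t}  (membership proof irrelevant,
  -- so this is a genuine subset of V)
  NonTargets : V → Set
  NonTargets s = Σ V (λ t → Irrelevant (Vertex t × ¬ (s ⟶ t)))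

  -- equal cardinality = existence of a bijection
  CoOutRegular : Set
  CoOutRegular = ∀ {s s'} → Vertex s → Vertex s' → NonTargets s ↔ NonTargets s'

  -- G = C⟨M,Q⟩ for the magma (M, _∙_): M is (an injective copy ι of) a
  -- set of vertices, Q ⊆ M is given by the injection ε : Q → M, and
  -- ⟨_⟩ : Q → A is injective.
  GenCayley : (M : Set) → (M → M → M) → Set₁
  GenCayley M _∙_ =
    Σ (M → V) λ ι → Injective ι ×
    Σ Set λ Q → Σ (Q → M) λ ε → Injective ε ×
    Σ (Q → A) λ ⟨_⟩ → Injective ⟨_⟩ ×
    (∀ s a t → G s a t ⇔ (∃[ p ] ∃[ q ] (s ≡ ι p × a ≡ ⟨ q ⟩ × t ≡ ι (p ∙ ε q))))

module _ {M : Set} (_∙_ : M → M → M) where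

  IsLeftQuasigroup : Set
  IsLeftQuasigroup = ∀ p q → ∃[ r ] (p ∙ r ≡ q × (∀ r' → p ∙ r' ≡ q → r ≡ r'))

  IsLeftIdentity IsRightIdentity IsIdentity : M → Set
  IsLeftIdentity e = ∀ p → e ∙ p ≡ p
  IsRightIdentity e = ∀ p → p ∙ e ≡ p
  IsIdentity e = IsLeftIdentity e × IsRightIdentity e

module _ {V A : Set} (G : Graph V A) where

  CayleyLQ : Set₁
  CayleyLQ = ∃[ M ] Σ (M → M → M) λ op → IsLeftQuasigroup op × GenCayley G M op

  CayleyLQLeftId : Set₁
  CayleyLQLeftId = ∃[ M ] Σ (M → M → M) λ op →
    IsLeftQuasigroup op × (∃[ e ] IsLeftIdentity op e) × GenCayley G M op

  CayleyLQRightId : Set₁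
  CayleyLQRightId = ∃[ M ] Σ (M → M → M) λ op →
    IsLeftQuasigroup op × (∃[ e ] IsRightIdentity op e) × GenCayley G M op

  CayleyLQId : Set₁
  CayleyLQId = ∃[ M ] Σ (M → M → M) λ op →
    IsLeftQuasigroup op × (∃[ e ] IsIdentity op e) × GenCayley G M op

-- In a Cayley graph of a left-quasigroup the out-neighbours of p form the image
-- p ∙ Q of Q under the bijection p ∙_, so the non-targets of p and of p′ correspond
-- under p′ ∙ (p \\ _). Conversely the vertices carry a left-quasigroup: fixing a
-- vertex e, the translation p ∙_ sends the a-successor of e to the a-successor of p,
-- and co-out-regularity extends this to a bijection of all vertices. Passing to the
-- isotope p ⋆ r = p ∙ (e \\ r) makes e a left identity without changing the graph,
-- and keeps e a right identity if it was one.
module Submission where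

open import Defs
open import Data.Empty using (⊥-elim; ⊥-elim-irr)
open import Data.Irrelevant using (Irrelevant; [_])
open import Data.Product using (Σ; ∃-syntax; _×_; _,_; proj₁; proj₂)
open import Data.Sum using (_⊎_; inj₁; inj₂)
open import Data.Sum.Function.Propositional using (_⊎-↔_)
open import Function.Base using (_∘_)
open import Function.Bundles using (_↔_; _⇔_; Inverse; Equivalence; mk↔ₛ′; mk⇔)
open import Function.Construct.Composition using (_↔-∘_)
open import Function.Construct.Identity using (↔-id)
open import Function.Construct.Symmetry using (↔-sym)
open import Relation.Binary.Definitions using (DecidableEquality)
open import Relation.Binary.PropositionalEquality using (_≡_; refl; sym; trans; cong; subst; module ≡-Reasoning)
open import Relation.Nullary using (¬_; Dec; yes; no; recompute)

Subtype : {X : Set} → (X → Set) → Set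
Subtype {X} P = Σ X λ x → Irrelevant (P x)

proj₁-injective : {X : Set} {P : X → Set} → Injective (proj₁ {B = λ x → Irrelevant (P x)})
proj₁-injective {x = _ , _} {y = _ , _} refl = refl

ImageComplement : {Q M : Set} → (Q → M) → Set
ImageComplement f = Subtype λ m → ¬ (∃[ q ] f q ≡ m)

image⊎complement : Classical → {Q M : Set} (f : Q → M) → Injective f →
                   M ↔ (Q ⊎ ImageComplement f)
image⊎complement cl {Q} {M} f f-injective =
  mk↔ₛ′ (λ m → classify m (cl _)) reflect
    (λ x → classify-reflect x (cl _)) (λ m → reflect-classify m (cl _))
  where
  classify : (m : M) → Dec (∃[ q ] f q ≡ m) → Q ⊎ ImageComplement f
  classify m (yes (q , _)) = inj₁ q
  classify m (no missed)   = inj₂ (m , [ missed ])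

  reflect : Q ⊎ ImageComplement f → M
  reflect (inj₁ q)       = f q
  reflect (inj₂ (m , _)) = m

  reflect-classify : ∀ m hit? → reflect (classify m hit?) ≡ m
  reflect-classify m (yes (q , fq≡m)) = fq≡m
  reflect-classify m (no _)           = refl

  classify-reflect : ∀ x hit? → classify (reflect x) hit? ≡ x
  classify-reflect (inj₁ q)                (yes (_ , fq′≡fq)) = cong inj₁ (f-injective fq′≡fq)
  classify-reflect (inj₁ q)                (no missed)        = ⊥-elim (missed (q , refl))
  classify-reflect (inj₂ (_ , [ missed ])) (yes hit)          = ⊥-elim-irr (missed hit)
  classify-reflect (inj₂ _)                (no _)             = refl

imageComplement-∘ : {Q M N : Set} (h : M ↔ N) (f : Q → M) →
                    ImageComplement f ↔ ImageComplement (Inverse.to h ∘ f)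
imageComplement-∘ h f =
  mk↔ₛ′ (λ { (m , [ missed ]) → to m , [ (λ { (q , eq) → missed (q , from-to eq) }) ] })
        (λ { (n , [ missed ]) → from n , [ (λ { (q , eq) → missed (q , to-from eq) }) ] })
        (λ _ → proj₁-injective (strictlyInverseˡ _))
        (λ _ → proj₁-injective (strictlyInverseʳ _))
  where
  open Inverse h
  from-to : ∀ {m m′} → to m ≡ to m′ → m ≡ m′
  from-to {m} {m′} eq = trans (sym (strictlyInverseʳ m)) (trans (cong from eq) (strictlyInverseʳ m′))
  to-from : ∀ {m n} → m ≡ from n → to m ≡ n
  to-from {n = n} eq = trans (cong to eq) (strictlyInverseˡ n)

module Transposition {Y : Set} (_≟_ : DecidableEquality Y) (a b : Y) where

  swapBy : (y : Y) → Dec (y ≡ a) → Dec (y ≡ b) → Y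
  swapBy _ (yes _) _       = b
  swapBy _ (no _)  (yes _) = a
  swapBy y (no _)  (no _)  = y

  swap : Y → Y
  swap y = swapBy y (y ≟ a) (y ≟ b)

  swap-a : swap a ≡ b
  swap-a with a ≟ a
  ... | yes _  = refl
  ... | no a≢a = ⊥-elim (a≢a refl)

  swapBy-involutive : ∀ y y≟a y≟b z≟a z≟b → swapBy (swapBy y y≟a y≟b) z≟a z≟b ≡ y
  swapBy-involutive y (yes refl) _          (yes b≡a) _         = b≡a
  swapBy-involutive y (yes refl) _          (no _)    (yes _)   = refl
  swapBy-involutive y (yes refl) _          (no _)    (no b≢b)  = ⊥-elim (b≢b refl)
  swapBy-involutive y (no _)     (yes refl) (yes _)   _         = refl
  swapBy-involutive y (no _)     (yes refl) (no a≢a)  _         = ⊥-elim (a≢a refl)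
  swapBy-involutive y (no y≢a)   (no _)     (yes y≡a) _         = ⊥-elim (y≢a y≡a)
  swapBy-involutive y (no _)     (no y≢b)   (no _)    (yes y≡b) = ⊥-elim (y≢b y≡b)
  swapBy-involutive y (no _)     (no _)     (no _)    (no _)    = refl

  swap-involutive : ∀ y → swap (swap y) ≡ y
  swap-involutive y = swapBy-involutive y (y ≟ a) (y ≟ b) (swap y ≟ a) (swap y ≟ b)

  transposition : Y ↔ Y
  transposition = mk↔ₛ′ swap swap swap-involutive swap-involutive

redirect : {X Y : Set} → DecidableEquality Y → (h : X ↔ Y) (x : X) (y : Y) →
           Σ (X ↔ Y) λ h′ → Inverse.to h′ x ≡ y
redirect _≟_ h x y = transposition ↔-∘ h , swap-a
  where open Transposition _≟_ (Inverse.to h x) y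

module LeftQuasigroup {M : Set} {_∙_ : M → M → M} (lq : IsLeftQuasigroup _∙_) where

  _\\_ : M → M → M
  p \\ q = proj₁ (lq p q)

  ∙-\\ : ∀ p q → p ∙ (p \\ q) ≡ q
  ∙-\\ p q = proj₁ (proj₂ (lq p q))

  \\-∙ : ∀ p r → p \\ (p ∙ r) ≡ r
  \\-∙ p r = proj₂ (proj₂ (lq p (p ∙ r))) r refl

  ∙-cancelˡ : ∀ p → Injective (p ∙_)
  ∙-cancelˡ p {r} {r′} eq = trans (sym (\\-∙ p r)) (trans (cong (p \\_) eq) (\\-∙ p r′))

  leftMultiplication : M → M ↔ M
  leftMultiplication p = mk↔ₛ′ (p ∙_) (p \\_) (∙-\\ p) (\\-∙ p)

↔⇒isLeftQuasigroup : {M : Set} (L : M → M ↔ M) → IsLeftQuasigroup (λ p → Inverse.to (L p))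
↔⇒isLeftQuasigroup L p q =
  from q , strictlyInverseˡ q , λ r eq → trans (cong from (sym eq)) (strictlyInverseʳ r)
  where open Inverse (L p)

Presents : {V A M Q : Set} → Graph V A → (M → V) → (Q → A) → (M → Q → M) → Set
Presents G ι ⟨_⟩ step =
  ∀ s a t → G s a t ⇔ (∃[ p ] ∃[ q ] (s ≡ ι p × a ≡ ⟨ q ⟩ × t ≡ ι (step p q)))

Presents-cong : {V A M Q : Set} {G : Graph V A} {ι : M → V} {⟨_⟩ : Q → A} {step step′ : M → Q → M} →
                (∀ p q → step p q ≡ step′ p q) → Presents G ι ⟨_⟩ step → Presents G ι ⟨_⟩ step′
Presents-cong {ι = ι} step≗step′ presents s a t = mk⇔
  (λ g → let (p , q , s≡ , a≡ , t≡) = Equivalence.to (presents s a t) g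
         in p , q , s≡ , a≡ , trans t≡ (cong ι (step≗step′ p q)))
  (λ { (p , q , s≡ , a≡ , t≡) →
         Equivalence.from (presents s a t) (p , q , s≡ , a≡ , trans t≡ (cong ι (sym (step≗step′ p q)))) })

module Presentation {V A M Q : Set} (G : Graph V A)
  {ι : M → V} (ι-injective : Injective ι) {⟨_⟩ : Q → A} (⟨⟩-injective : Injective ⟨_⟩)
  {step : M → Q → M} (presents : Presents G ι ⟨_⟩ step) where

  edge : ∀ p q → G (ι p) ⟨ q ⟩ (ι (step p q))
  edge p q = Equivalence.from (presents _ _ _) (p , q , refl , refl , refl)

  unfold : ∀ {s a t} → G s a t → ∃[ p ] ∃[ q ] (s ≡ ι p × a ≡ ⟨ q ⟩ × t ≡ ι (step p q))
  unfold = Equivalence.to (presents _ _ _)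

  edge⇒step : ∀ {p a m} → G (ι p) a (ι m) → ∃[ q ] step p q ≡ m
  edge⇒step g with unfold g
  ... | _ , q , s≡ , _ , t≡ with ι-injective s≡
  ... | refl = q , sym (ι-injective t≡)

  some-label : NonEmpty G → Q
  some-label (_ , _ , _ , g) = proj₁ (proj₂ (unfold g))

  vertex⇒image : ∀ {s} → Vertex G s → ∃[ m ] s ≡ ι m
  vertex⇒image (inj₁ (_ , _ , g)) = let (p , _ , s≡ , _) = unfold g in p , s≡
  vertex⇒image (inj₂ (_ , _ , g)) = let (p , q , _ , _ , t≡) = unfold g in step p q , t≡

  image-vertex : Q → ∀ m → Vertex G (ι m)
  image-vertex q m = inj₁ (⟨ q ⟩ , ι (step m q) , edge m q)

  deterministic : Deterministic G
  deterministic g g′ with unfold g | unfold g′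
  ... | p , q , refl , refl , refl | _ , _ , r≡ , a≡ , refl with ι-injective r≡ | ⟨⟩-injective a≡
  ... | refl | refl = refl

  sourceComplete : SourceComplete G
  sourceComplete vs (_ , _ , g) with vertex⇒image vs | unfold g
  ... | p , refl | _ , q , _ , refl , _ = ι (step p q) , edge p q

  steps-injective⇒simple : (∀ p → Injective (step p)) → Simple G
  steps-injective⇒simple step-injective g g′ with unfold g | unfold g′
  ... | p , q , refl , refl , t≡ | _ , _ , s≡ , refl , t≡′ with ι-injective s≡
  ... | refl = cong ⟨_⟩ (step-injective p (ι-injective (trans (sym t≡) t≡′)))

  simple⇒step-injective : Simple G → ∀ p → Injective (step p)
  simple⇒step-injective simple p {q} {q′} eq =
    ⟨⟩-injective (simple (edge p q) (subst (G (ι p) ⟨ q′ ⟩ ∘ ι) (sym eq) (edge p q′)))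

  idle⇒loopComplete : (∀ {p q} → step p q ≡ p → ∀ m → step m q ≡ m) → LoopComplete G
  idle⇒loopComplete idle (_ , g) vw with unfold g | vertex⇒image vw
  ... | _ , q , refl , refl , loop | m , refl =
    subst (G (ι m) ⟨ q ⟩ ∘ ι) (idle (sym (ι-injective loop)) m) (edge m q)

  -- Vertex-hood of a non-target is irrelevant, so classical logic is needed to
  -- recover its preimage under ι.
  nonTargets↔imageComplement : Classical → Q → ∀ p → NonTargets G (ι p) ↔ ImageComplement (step p)
  nonTargets↔imageComplement cl q₀ p = mk↔ₛ′ to from
    (λ { (m , _) → proj₁-injective (sym (ι-injective (proj₂ (locate (ι m) (image-vertex q₀ m))))) })
    (λ { (t , [ v ]) → proj₁-injective (sym (proj₂ (locate t (proj₁ v)))) })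
    where
    locate : ∀ t → .(Vertex G t) → ∃[ m ] t ≡ ι m
    locate t v = vertex⇒image (recompute (cl _) v)

    to : NonTargets G (ι p) → ImageComplement (step p)
    to (t , [ v ]) = let (m , t≡) = locate t (proj₁ v) in
      m , [ (λ { (q , eq) → proj₂ v (⟨ q ⟩ , subst (G (ι p) ⟨ q ⟩) (trans (cong ι eq) (sym t≡)) (edge p q)) }) ]

    from : ImageComplement (step p) → NonTargets G (ι p)
    from (m , [ missed ]) = ι m , [ image-vertex q₀ m , (λ (_ , g) → missed (edge⇒step g)) ]

  equinumerousComplements⇒coOutRegular : Classical → Q →
    (∀ p p′ → ImageComplement (step p) ↔ ImageComplement (step p′)) → CoOutRegular G
  equinumerousComplements⇒coOutRegular cl q₀ complements vs vs′
    with vertex⇒image vs | vertex⇒image vs′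
  ... | p , refl | p′ , refl =
    ↔-sym (nonTargets↔imageComplement cl q₀ p′) ↔-∘ (complements p p′ ↔-∘ nonTargets↔imageComplement cl q₀ p)

module Isotope {M : Set} {_∙_ : M → M → M} (lq : IsLeftQuasigroup _∙_) (e : M) where
  open LeftQuasigroup lq

  _⋆_ : M → M → M
  p ⋆ r = p ∙ (e \\ r)

  ⋆-isLeftQuasigroup : IsLeftQuasigroup _⋆_
  ⋆-isLeftQuasigroup =
    ↔⇒isLeftQuasigroup (λ p → leftMultiplication p ↔-∘ ↔-sym (leftMultiplication e))

  ⋆-leftIdentity : IsLeftIdentity _⋆_ e
  ⋆-leftIdentity = ∙-\\ e

  ⋆-rightIdentity : IsRightIdentity _∙_ e → IsRightIdentity _⋆_ e
  ⋆-rightIdentity rightId p =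
    trans (cong (p ∙_) (trans (cong (e \\_) (sym (rightId e))) (\\-∙ e e))) (rightId p)

  ⋆-genCayley : {V A : Set} {G : Graph V A} → GenCayley G M _∙_ → GenCayley G M _⋆_
  ⋆-genCayley (ι , ι-injective , Q , ε , ε-injective , ⟨_⟩ , ⟨⟩-injective , presents) =
    ι , ι-injective , Q , (e ∙_) ∘ ε , ε-injective ∘ ∙-cancelˡ e , ⟨_⟩ , ⟨⟩-injective ,
    Presents-cong (λ p q → cong (p ∙_) (sym (\\-∙ e (ε q)))) presents

module _ {V A : Set} {G : Graph V A} where

  cayleyLQ⇒cayleyLQLeftId : NonEmpty G → CayleyLQ G → CayleyLQLeftId G
  cayleyLQ⇒cayleyLQLeftId (s , a , t , g) (M , _∙_ , lq , cayley@(_ , _ , _ , _ , _ , _ , _ , presents)) =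
    M , _⋆_ , ⋆-isLeftQuasigroup , (e , ⋆-leftIdentity) , ⋆-genCayley cayley
    where
    e : M
    e = proj₁ (Equivalence.to (presents s a t) g)
    open Isotope lq e

  cayleyLQRightId⇒cayleyLQId : CayleyLQRightId G → CayleyLQId G
  cayleyLQRightId⇒cayleyLQId (M , _∙_ , lq , (e , rightId) , cayley) =
    M , _⋆_ , ⋆-isLeftQuasigroup , (e , ⋆-leftIdentity , ⋆-rightIdentity rightId) , ⋆-genCayley cayley
    where open Isotope lq e

  cayleyLQLeftId⇒cayleyLQ : CayleyLQLeftId G → CayleyLQ G
  cayleyLQLeftId⇒cayleyLQ (M , _∙_ , lq , _ , cayley) = M , _∙_ , lq , cayley

  cayleyLQId⇒cayleyLQRightId : CayleyLQId G → CayleyLQRightId G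
  cayleyLQId⇒cayleyLQRightId (M , _∙_ , lq , (e , _ , rightId) , cayley) = M , _∙_ , lq , (e , rightId) , cayley

module CayleyGraph (cl : Classical) {V A : Set} {G : Graph V A} (nonEmpty : NonEmpty G)
  {M : Set} {_∙_ : M → M → M} (lq : IsLeftQuasigroup _∙_)
  {ι : M → V} (ι-injective : Injective ι) {Q : Set} {ε : Q → M} (ε-injective : Injective ε)
  {⟨_⟩ : Q → A} (⟨⟩-injective : Injective ⟨_⟩) (presents : Presents G ι ⟨_⟩ (λ p q → p ∙ ε q)) where

  open LeftQuasigroup lq
  open Presentation G ι-injective ⟨⟩-injective presents public

  simple : Simple G
  simple = steps-injective⇒simple (λ p → ε-injective ∘ ∙-cancelˡ p)

  coOutRegular : CoOutRegular G
  coOutRegular = equinumerousComplements⇒coOutRegular cl (some-label nonEmpty) λ p p′ →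
    imageComplement-∘ (leftMultiplication p′) ε ↔-∘ ↔-sym (imageComplement-∘ (leftMultiplication p) ε)

  loopComplete : ∀ {e} → IsRightIdentity _∙_ e → LoopComplete G
  loopComplete rightId = idle⇒loopComplete λ {p} {q} pεq≡p m →
    let εq≡e = ∙-cancelˡ p (trans pεq≡p (sym (rightId p)))
    in trans (cong (m ∙_) εq≡e) (rightId m)

module _ (cl : Classical) {V A : Set} {G : Graph V A} (nonEmpty : NonEmpty G) where

  cayleyLQ⇒properties : CayleyLQ G → Simple G × Deterministic G × SourceComplete G × CoOutRegular G
  cayleyLQ⇒properties (_ , _ , lq , _ , ι-injective , _ , _ , ε-injective , _ , ⟨⟩-injective , presents) =
    simple , deterministic , sourceComplete , coOutRegular
    where open CayleyGraph cl nonEmpty lq ι-injective ε-injective ⟨⟩-injective presents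

  cayleyLQRightId⇒properties : CayleyLQRightId G →
    Simple G × Deterministic G × SourceComplete G × LoopComplete G × CoOutRegular G
  cayleyLQRightId⇒properties
    (_ , _ , lq , (_ , rightId) , _ , ι-injective , _ , _ , ε-injective , _ , ⟨⟩-injective , presents) =
    simple , deterministic , sourceComplete , loopComplete rightId , coOutRegular
    where open CayleyGraph cl nonEmpty lq ι-injective ε-injective ⟨⟩-injective presents

module Reconstruction (cl : Classical) {V A : Set} {G : Graph V A} (nonEmpty : NonEmpty G)
  (simple : Simple G) (deterministic : Deterministic G) (sourceComplete : SourceComplete G) where

  Vtx Lbl : Set
  Vtx = Subtype (Vertex G)
  Lbl = Subtype (Label G)

  outgoing : (p : Vtx) (q : Lbl) → ∃[ t ] G (proj₁ p) (proj₁ q) t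
  outgoing (_ , [ vs ]) (_ , [ la ]) = sourceComplete (recompute (cl _) vs) (recompute (cl _) la)

  successor : Vtx → Lbl → Vtx
  successor p q = proj₁ (outgoing p q) , [ inj₂ (proj₁ p , proj₁ q , proj₂ (outgoing p q)) ]

  successor-edge : ∀ p q → G (proj₁ p) (proj₁ q) (proj₁ (successor p q))
  successor-edge p q = proj₂ (outgoing p q)

  presents : Presents G proj₁ proj₁ successor
  presents s a t = mk⇔
    (λ g → let p = s , [ inj₁ (a , t , g) ]; q = a , [ s , t , g ] in
           p , q , refl , refl , deterministic g (successor-edge p q))
    (λ { (p , q , refl , refl , refl) → successor-edge p q })

  open Presentation G proj₁-injective proj₁-injective {step = successor} presents
    using (image-vertex; some-label; simple⇒step-injective; nonTargets↔imageComplement)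

  s₀ : V
  s₀ = proj₁ nonEmpty

  e : Vtx
  e = s₀ , [ inj₁ (proj₂ nonEmpty) ]

  ε : Lbl → Vtx
  ε = successor e

  split : ∀ p → Vtx ↔ (Lbl ⊎ ImageComplement (successor p))
  split p = image⊎complement cl (successor p) (simple⇒step-injective simple p)

  module Translations (F : ∀ p → ImageComplement ε ↔ ImageComplement (successor p)) where

    translation : Vtx → Vtx ↔ Vtx
    translation p = ↔-sym (split p) ↔-∘ ((↔-id Lbl ⊎-↔ F p) ↔-∘ split e)

    _∙_ : Vtx → Vtx → Vtx
    p ∙ r = Inverse.to (translation p) r

    ∙-complement : ∀ p x → p ∙ proj₁ x ≡ proj₁ (Inverse.to (F p) x)
    ∙-complement p x = cong (Inverse.from (split p) ∘ Inverse.to (↔-id Lbl ⊎-↔ F p))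
                              (Inverse.strictlyInverseˡ (split e) (inj₂ x))

    ∙-ε : ∀ p q → p ∙ ε q ≡ successor p q
    ∙-ε p q = cong (Inverse.from (split p) ∘ Inverse.to (↔-id Lbl ⊎-↔ F p))
                   (Inverse.strictlyInverseˡ (split e) (inj₁ q))

    genCayley : GenCayley G Vtx _∙_
    genCayley = proj₁ , proj₁-injective , Lbl , ε , simple⇒step-injective simple e , proj₁ , proj₁-injective ,
      Presents-cong (λ p q → sym (∙-ε p q)) presents

    cayleyLQ : CayleyLQ G
    cayleyLQ = Vtx , _∙_ , ↔⇒isLeftQuasigroup translation , genCayley

    cayleyLQRightId : IsRightIdentity _∙_ e → CayleyLQRightId G
    cayleyLQRightId rightId = Vtx , _∙_ , ↔⇒isLeftQuasigroup translation , (e , rightId) , genCayley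

    loop⇒rightIdentity : LoopComplete G → ∃[ a ] G s₀ a s₀ → IsRightIdentity _∙_ e
    loop⇒rightIdentity loopComplete (a , loop) p = begin
      p ∙ e          ≡⟨ cong (p ∙_) (sym εq≡e) ⟩
      p ∙ ε q        ≡⟨ ∙-ε p q ⟩
      successor p q  ≡⟨ proj₁-injective (deterministic (successor-edge p q) loop-at-p) ⟩
      p              ∎
      where
      open ≡-Reasoning
      q : Lbl
      q = a , [ s₀ , s₀ , loop ]
      εq≡e : ε q ≡ e
      εq≡e = proj₁-injective (deterministic (successor-edge e q) loop)
      loop-at-p : G (proj₁ p) a (proj₁ p)
      loop-at-p = loopComplete (s₀ , loop) (image-vertex q p)

    redirected⇒rightIdentity : (unmoved : ∀ p → ¬ (∃[ q ] successor p q ≡ p)) →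
      (∀ p → Inverse.to (F p) (e , [ unmoved e ]) ≡ (p , [ unmoved p ])) → IsRightIdentity _∙_ e
    redirected⇒rightIdentity unmoved fixes p = trans (∙-complement p (e , [ unmoved e ])) (cong proj₁ (fixes p))

  comparison : CoOutRegular G → ∀ p → ImageComplement ε ↔ ImageComplement (successor p)
  comparison coOutRegular p =
    nonTargets↔imageComplement cl q₀ p ↔-∘
      (coOutRegular (image-vertex q₀ e) (image-vertex q₀ p) ↔-∘ ↔-sym (nonTargets↔imageComplement cl q₀ e))
    where q₀ = some-label nonEmpty

  coOutRegular⇒cayleyLQ : CoOutRegular G → CayleyLQ G
  coOutRegular⇒cayleyLQ coOutRegular = cayleyLQ
    where open Translations (comparison coOutRegular)

  -- Without a loop at s₀ no vertex carries a loop, so e and every p are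
  -- non-targets of themselves and the comparison may be redirected to send e to p.
  loopComplete⇒cayleyLQRightId : LoopComplete G → CoOutRegular G → CayleyLQRightId G
  loopComplete⇒cayleyLQRightId loopComplete coOutRegular with cl (∃[ a ] G s₀ a s₀)
  ... | yes loop = cayleyLQRightId (loop⇒rightIdentity loopComplete loop)
    where open Translations (comparison coOutRegular)
  ... | no noLoop = cayleyLQRightId (redirected⇒rightIdentity unmoved (proj₂ ∘ redirected))
    where
    unmoved : ∀ p → ¬ (∃[ q ] successor p q ≡ p)
    unmoved p (q , loop) = noLoop (proj₁ q ,
      loopComplete (proj₁ p , subst (G (proj₁ p) (proj₁ q) ∘ proj₁) loop (successor-edge p q)) (image-vertex q e))

    redirected : ∀ p → Σ (ImageComplement ε ↔ ImageComplement (successor p))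
                         λ h → Inverse.to h (e , [ unmoved e ]) ≡ (p , [ unmoved p ])
    redirected p =
      redirect (λ x y → cl (x ≡ y)) (comparison coOutRegular p) (e , [ unmoved e ]) (p , [ unmoved p ])

    open Translations (proj₁ ∘ redirected)

module _ (cl : Classical) {V A : Set} {G : Graph V A} (nonEmpty : NonEmpty G) where

  properties⇒cayleyLQ : Simple G × Deterministic G × SourceComplete G × CoOutRegular G → CayleyLQ G
  properties⇒cayleyLQ (simple , deterministic , sourceComplete , coOutRegular) =
    coOutRegular⇒cayleyLQ coOutRegular
    where open Reconstruction cl nonEmpty simple deterministic sourceComplete

  properties⇒cayleyLQRightId :
    Simple G × Deterministic G × SourceComplete G × LoopComplete G × CoOutRegular G → CayleyLQRightId G
  properties⇒cayleyLQRightId (simple , deterministic , sourceComplete , loopComplete , coOutRegular) =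
    loopComplete⇒cayleyLQRightId loopComplete coOutRegular
    where open Reconstruction cl nonEmpty simple deterministic sourceComplete

theorem6p5 : Classical → {V A : Set} (G : Graph V A) → NonEmpty G →
    ((CayleyLQ G ⇔ CayleyLQLeftId G)
      × (CayleyLQLeftId G ⇔ (Simple G × Deterministic G × SourceComplete G × CoOutRegular G)))
    × ((CayleyLQRightId G ⇔ CayleyLQId G)
      × (CayleyLQId G ⇔ (Simple G × Deterministic G × SourceComplete G × LoopComplete G × CoOutRegular G)))
theorem6p5 cl G nonEmpty =
  ( mk⇔ (cayleyLQ⇒cayleyLQLeftId nonEmpty) cayleyLQLeftId⇒cayleyLQ
  , mk⇔ (cayleyLQ⇒properties cl nonEmpty ∘ cayleyLQLeftId⇒cayleyLQ)
        (cayleyLQ⇒cayleyLQLeftId nonEmpty ∘ properties⇒cayleyLQ cl nonEmpty) )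
  , ( mk⇔ cayleyLQRightId⇒cayleyLQId cayleyLQId⇒cayleyLQRightId
    , mk⇔ (cayleyLQRightId⇒properties cl nonEmpty ∘ cayleyLQId⇒cayleyLQRightId)
          (cayleyLQRightId⇒cayleyLQId ∘ properties⇒cayleyLQRightId cl nonEmpty) )
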